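{- For each integer $n\geq 2$, $pd(K_n)=\lceil n/2\rceil$, where $K_n$ is the complete graph on $n$ vertices.
   Context: All graphs are simple, finite and undirected. For an edge-coloring $c$ of a graph $G$, a set $F\subseteq E(G)$ is a proper cut if $G-F$ is disconnected and any two edges of $F$ sharing an endpoint receive different colors. A proper cut $F$ separates two vertices $x,y$ if $x$ and $y$ lie in different components of $G-F$. An edge-colored graph is proper disconnected if for every pair of distinct vertices there is a proper cut separating them. For a connected graph $G$, the proper disconnection number $pd(G)$ is the minimum $k$ such that there is an edge-coloring $c:E(G)\to\{1,\dots,k\}$ making $G$ proper disconnected. -}

module Defs where

open import Data.Nat using (ℕ; _≤_)
open import Data.Fin using (Fin)
open import Data.Product using (Σ; _×_; ∃; ∃-syntax)
open import Relation.Nullary using (¬_)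
open import Relation.Binary.PropositionalEquality using (_≡_; _≢_; refl; sym)

record Graph (n : ℕ) : Set₁ where
  field
    Adj     : Fin n → Fin n → Set
    Adj-sym : ∀ {u v} → Adj u v → Adj v u
    irrefl  : ∀ {u} → ¬ Adj u u
open Graph public

K : (n : ℕ) → Graph n
K n = record
  { Adj     = λ u v → u ≢ v
  ; Adj-sym = λ p q → p (sym q)
  ; irrefl  = λ p → p refl
  }

module _ {n : ℕ} (G : Graph n) where

  data Reach (A : Fin n → Fin n → Set) : Fin n → Fin n → Set where
    here : ∀ {u} → Reach A u u
    step : ∀ {u v w} → A u v → Reach A v w → Reach A u w

  Connected : Set
  Connected = ∀ u v → Reach (Adj G) u v

  -- An edge-coloring of G with colors Fin k: the color of edge uv is
  -- col u v; it must not depend on orientation. (Values on non-edges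
  -- are irrelevant.)
  record EdgeColoring (k : ℕ) : Set where
    field
      col     : Fin n → Fin n → Fin k
      col-sym : ∀ {u v} → Adj G u v → col u v ≡ col v u
  open EdgeColoring public

  record EdgeSet : Set₁ where
    field
      Mem     : Fin n → Fin n → Set
      Mem-sub : ∀ {u v} → Mem u v → Adj G u v
      Mem-sym : ∀ {u v} → Mem u v → Mem v u
  open EdgeSet public

  AdjMinus : EdgeSet → Fin n → Fin n → Set
  AdjMinus F u v = Adj G u v × ¬ Mem F u v

  Disconnected- : EdgeSet → Set
  Disconnected- F = ∃[ u ] ∃[ v ] ¬ Reach (AdjMinus F) u v

  IsProperCut : ∀ {k} → EdgeColoring k → EdgeSet → Set
  IsProperCut c F =
    Disconnected- F ×
    (∀ u v w → Mem F u v → Mem F u w → v ≢ w → col c u v ≢ col c u w)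

  Separates : EdgeSet → Fin n → Fin n → Set
  Separates F x y = ¬ Reach (AdjMinus F) x y

  ProperDisconnected : ∀ {k} → EdgeColoring k → Set₁
  ProperDisconnected c =
    ∀ x y → x ≢ y → Σ EdgeSet λ F → IsProperCut c F × Separates F x y

  IsPD : ℕ → Set₁
  IsPD k =
    (Σ (EdgeColoring k) ProperDisconnected) ×
    (∀ k' → (c : EdgeColoring k') → ProperDisconnected c → k ≤ k')

module Submission where

-- Both bounds rest on the observation that n ≤ k + k exactly when Fin n
-- injects into two copies Fin k ⊎ Fin k of the colour set.
--
-- Let F be a proper cut separating two vertices x and y, and
-- let S be the side of x in K_n - F.  Every edge from S to its complement
-- lies in F.  Coding z ∈ S by the colour of yz and z ∉ S by the colour of
-- xz is injective, because the cut edges at y (resp. at x) carry distinct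
-- colours; hence n ≤ k + k.  Membership in S is only classically
-- decidable, which is harmless since the conclusion is decidable.
--
-- Place the vertices injectively in two layers Fin k ⊎ Fin k
-- (k = ⌈n/2⌉) and colour uv by the sum of the residues of u and v modulo k.
-- For a Boolean vertex labelling, the edges with differently labelled ends
-- form a cut separating any two differently labelled vertices.  If the
-- labelling distinguishes the two vertices of each residue class, the cut
-- edges at a vertex go to vertices of distinct residues, hence have
-- distinct colours.  Flipping the labels of one residue class of the layer
-- labelling yields such a labelling separating any prescribed pair.

open import Defs
open import Data.Nat using (ℕ; _≤_; ⌈_/2⌉)
open import Data.Nat.Base using (zero; suc; _+_; _∸_; s≤s; NonZero)
open import Data.Nat.Properties
  using (_≤?_; <⇒≤; +-comm; +-assoc; +-monoˡ-≤; m∸n+n≡m; ⌈n/2⌉-mono;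
         n≡⌈n+n/2⌉; ⌊n/2⌋≤⌈n/2⌉; ⌊n/2⌋+⌈n/2⌉≡n)
open import Data.Nat.DivMod using (_%_; _mod_; m%n<n; m<n⇒m%n≡m; %-congˡ; %-distribˡ-+; [m+n]%n≡m%n)
open import Data.Fin.Base as Fin using (Fin; toℕ; splitAt; join; inject≤)
open import Data.Fin.Properties
  using (_≟_; toℕ-injective; toℕ<n; fromℕ<-injective; injective⇒≤; inject≤-injective;
         splitAt-join; join-splitAt)
open import Data.Bool.Base using (Bool; true; false; _xor_)
open import Data.Bool.Properties as Bool using (xor-assoc; xor-same; xor-identityʳ; xor-comm; ¬-not)
open import Data.Sum.Base using (_⊎_; inj₁; inj₂; reduce)
open import Data.Sum.Properties using (inj₁-injective; inj₂-injective)
open import Data.Product.Base using (Σ; _×_; _,_; proj₁; proj₂)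
open import Function.Base using (_∘_)
open import Function.Definitions using (Injective)
open import Relation.Nullary.Negation using (¬_; ¬¬-map)
open import Relation.Nullary.Decidable
  using (Dec; yes; no; does; decidable-stable; ¬¬-excluded-middle; dec-true; dec-false)
open import Relation.Binary.PropositionalEquality

-- Double negation commutes with a finite product; this lets the lower
-- bound case-split on finitely many undecided propositions.
¬¬-finite-choice : ∀ {m} {P : Fin m → Set} → (∀ i → ¬ ¬ P i) → ¬ ¬ (∀ i → P i)
¬¬-finite-choice {zero} _ notAll = notAll λ ()
¬¬-finite-choice {suc m} {P} h notAll =
  h Fin.zero λ p₀ →
  ¬¬-finite-choice {m} {P ∘ Fin.suc} (h ∘ Fin.suc) λ rest →
  notAll λ { Fin.zero → p₀ ; (Fin.suc i) → rest i }

xor-involutiveʳ : ∀ a c → (a xor c) xor c ≡ a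
xor-involutiveʳ a c = trans (xor-assoc a c c) (trans (cong (a xor_) (xor-same c)) (xor-identityʳ a))

xor-cancelʳ : ∀ {a b c} → a xor c ≡ b xor c → a ≡ b
xor-cancelʳ {a} {b} {c} e =
  trans (sym (xor-involutiveʳ a c)) (trans (cong (_xor c) e) (xor-involutiveʳ b c))

xor-cancelˡ : ∀ {a b c} → c xor a ≡ c xor b → a ≡ b
xor-cancelˡ {a} {b} {c} e = xor-cancelʳ (trans (xor-comm a c) (trans e (xor-comm c b)))

join-injective : ∀ k {a b : Fin k ⊎ Fin k} → join k k a ≡ join k k b → a ≡ b
join-injective k {a} {b} e =
  trans (sym (splitAt-join k k a)) (trans (cong (splitAt k) e) (splitAt-join k k b))

⊎-injection⇒≤ : ∀ {n k} (f : Fin n → Fin k ⊎ Fin k) → Injective _≡_ _≡_ f → n ≤ k + k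
⊎-injection⇒≤ {k = k} f f-injective = injective⇒≤ (f-injective ∘ join-injective k)

≤⇒⊎-injection : ∀ {n k} → n ≤ k + k → Σ (Fin n → Fin k ⊎ Fin k) (Injective _≡_ _≡_)
≤⇒⊎-injection {k = k} n≤k+k = place , place-injective
  where
  place : Fin _ → Fin k ⊎ Fin k
  place v = splitAt k (inject≤ v n≤k+k)

  place-injective : Injective _≡_ _≡_ place
  place-injective {u} {v} e = inject≤-injective n≤k+k n≤k+k u v
    (trans (sym (join-splitAt k k _)) (trans (cong (join k k) e) (join-splitAt k k _)))

n≤⌈n/2⌉+⌈n/2⌉ : ∀ n → n ≤ ⌈ n /2⌉ + ⌈ n /2⌉
n≤⌈n/2⌉+⌈n/2⌉ n = subst (_≤ ⌈ n /2⌉ + ⌈ n /2⌉) (⌊n/2⌋+⌈n/2⌉≡n n)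
  (+-monoˡ-≤ ⌈ n /2⌉ (⌊n/2⌋≤⌈n/2⌉ n))

⌈n/2⌉≤k : ∀ {n k} → n ≤ k + k → ⌈ n /2⌉ ≤ k
⌈n/2⌉≤k {n} {k} n≤k+k = subst (⌈ n /2⌉ ≤_) (sym (n≡⌈n+n/2⌉ k)) (⌈n/2⌉-mono n≤k+k)

module _ {k : ℕ} .{{_ : NonZero k}} where

  _⊕_ : Fin k → Fin k → Fin k
  a ⊕ b = (toℕ a + toℕ b) mod k

  ⊕-comm : ∀ a b → a ⊕ b ≡ b ⊕ a
  ⊕-comm a b = cong (_mod k) (+-comm (toℕ a) (toℕ b))

  %-cong-+ˡ : ∀ z {x y} → x % k ≡ y % k → (z + x) % k ≡ (z + y) % k
  %-cong-+ˡ z {x} {y} x≡y = begin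
    (z + x) % k             ≡⟨ %-distribˡ-+ z x k ⟩
    (z % k + x % k) % k     ≡⟨ cong (λ r → (z % k + r) % k) x≡y ⟩
    (z % k + y % k) % k     ≡⟨ %-distribˡ-+ z y k ⟨
    (z + y) % k             ∎
    where open ≡-Reasoning

  -- Adding a ≤ k is cancellable modulo k: add k ∸ a to both sides.
  %-cancel-+ˡ : ∀ {a} b c → a ≤ k → (a + b) % k ≡ (a + c) % k → b % k ≡ c % k
  %-cancel-+ˡ {a} b c a≤k eq = begin
    b % k                       ≡⟨ [m+n]%n≡m%n b k ⟨
    (b + k) % k                 ≡⟨ %-congˡ (complement b) ⟩
    ((k ∸ a) + (a + b)) % k     ≡⟨ %-cong-+ˡ (k ∸ a) eq ⟩
    ((k ∸ a) + (a + c)) % k     ≡⟨ %-congˡ (complement c) ⟨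
    (c + k) % k                 ≡⟨ [m+n]%n≡m%n c k ⟩
    c % k                       ∎
    where
    open ≡-Reasoning
    complement : ∀ x → x + k ≡ (k ∸ a) + (a + x)
    complement x = begin
      x + k               ≡⟨ +-comm x k ⟩
      k + x               ≡⟨ cong (_+ x) (m∸n+n≡m a≤k) ⟨
      (k ∸ a + a) + x     ≡⟨ +-assoc (k ∸ a) a x ⟩
      (k ∸ a) + (a + x)   ∎

  ⊕-cancelˡ : ∀ a {b c} → a ⊕ b ≡ a ⊕ c → b ≡ c
  ⊕-cancelˡ a {b} {c} eq = toℕ-injective (begin
    toℕ b         ≡⟨ m<n⇒m%n≡m (toℕ<n b) ⟨
    toℕ b % k     ≡⟨ %-cancel-+ˡ (toℕ b) (toℕ c) (<⇒≤ (toℕ<n a)) sums ⟩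
    toℕ c % k     ≡⟨ m<n⇒m%n≡m (toℕ<n c) ⟩
    toℕ c         ∎)
    where
    open ≡-Reasoning
    sums : (toℕ a + toℕ b) % k ≡ (toℕ a + toℕ c) % k
    sums = fromℕ<-injective _ _ (m%n<n (toℕ a + toℕ b) k) (m%n<n (toℕ a + toℕ c) k) eq

module _ {n : ℕ} {G : Graph n} where

  reach-snoc : ∀ {A : Fin n → Fin n → Set} {u v w} → Reach G A u v → A v w → Reach G A u w
  reach-snoc here a = step a here
  reach-snoc (step b r) a = step b (reach-snoc r a)

  -- An edge leaving the component of x in G - F must belong to F
  -- (only up to double negation, since membership in F is undecided).
  leaving-edge-in-cut : ∀ {F x a b} → Reach G (AdjMinus G F) x a → Separates G F x b →
                        Adj G a b → ¬ ¬ Mem F a b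
  leaving-edge-in-cut x↝a x∤b ab ab∉F = x∤b (reach-snoc x↝a (ab , ab∉F))

  ProperlyColoured : ∀ {k} → EdgeColoring G k → EdgeSet G → Set
  ProperlyColoured c F =
    ∀ u v w → Mem F u v → Mem F u w → v ≢ w → col c u v ≢ col c u w

  boundary : (Fin n → Bool) → EdgeSet G
  boundary g = record
    { Mem     = λ u v → Adj G u v × g u ≢ g v
    ; Mem-sub = proj₁
    ; Mem-sym = λ (uv , gu≢gv) → Adj-sym G uv , gu≢gv ∘ sym
    }

  boundary-invariant : ∀ g {u v} → Reach G (AdjMinus G (boundary g)) u v → g u ≡ g v
  boundary-invariant g here = refl
  boundary-invariant g {u} (step {v = w} (uw , uw∉∂) w↝v) =
    trans (decidable-stable (g u Bool.≟ g w) (λ gu≢gw → uw∉∂ (uw , gu≢gw)))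
          (boundary-invariant g w↝v)

  boundary-separates : ∀ g {x y} → g x ≢ g y → Separates G (boundary g) x y
  boundary-separates g gx≢gy x↝y = gx≢gy (boundary-invariant g x↝y)

  boundaries⇒properDisconnected :
    ∀ {k} (c : EdgeColoring G k) →
    (∀ x y → x ≢ y → Σ (Fin n → Bool) λ g → ProperlyColoured c (boundary g) × g x ≢ g y) →
    ProperDisconnected G c
  boundaries⇒properDisconnected c labelling x y x≢y =
    let (g , proper , gx≢gy) = labelling x y x≢y
        x∤y = boundary-separates g gx≢gy
    in  boundary g , ((x , y , x∤y) , proper) , x∤y

module CutBound {n k : ℕ} (c : EdgeColoring (K n) k) {F : EdgeSet (K n)}
                (proper : ProperlyColoured c F) {x y : Fin n}
                (x∤y : Separates (K n) F x y) where

  Side : Fin n → Set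
  Side z = Reach (K n) (AdjMinus (K n) F) x z

  crossing-edge : ∀ {a b} → Side a → ¬ Side b → ¬ ¬ Mem F a b
  crossing-edge x↝a x∤b = leaving-edge-in-cut {G = K n} {F = F} x↝a x∤b (λ a≡b → x∤b (subst Side a≡b x↝a))

  distinct-colours : ∀ {u v w} → ¬ ¬ Mem F u v → ¬ ¬ Mem F u w → v ≢ w → col c u v ≢ col c u w
  distinct-colours uv uw v≢w same = uv λ uv∈F → uw λ uw∈F → proper _ _ _ uv∈F uw∈F v≢w same

  -- Vertices on x's side are coded by their edge to y, the others by
  -- their edge to x; both kinds of edges lie in F.
  code : ∀ z → Dec (Side z) → Fin k ⊎ Fin k
  code z (yes _) = inj₁ (col c y z)
  code z (no _)  = inj₂ (col c x z)

  code-injective : ∀ {z z'} (d : Dec (Side z)) (d' : Dec (Side z')) →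
                   code z d ≡ code z' d' → z ≡ z'
  code-injective {z} {z'} (yes x↝z) (yes x↝z') e = decidable-stable (z ≟ z') λ z≢z' →
    distinct-colours (¬¬-map (Mem-sym F) (crossing-edge x↝z x∤y))
                     (¬¬-map (Mem-sym F) (crossing-edge x↝z' x∤y)) z≢z' (inj₁-injective e)
  code-injective {z} {z'} (no x∤z) (no x∤z') e = decidable-stable (z ≟ z') λ z≢z' →
    distinct-colours (crossing-edge here x∤z) (crossing-edge here x∤z') z≢z' (inj₂-injective e)
  code-injective (yes _) (no _) ()
  code-injective (no _) (yes _) ()

  cut-bound : n ≤ k + k
  cut-bound = decidable-stable (n ≤? k + k) λ n≰k+k →
    ¬¬-finite-choice (λ z → ¬¬-excluded-middle) λ side? →
    n≰k+k (⊎-injection⇒≤ (λ z → code z (side? z)) (code-injective _ _))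

pd-lower-bound : ∀ {n k} (c : EdgeColoring (K n) k) → ProperDisconnected (K n) c →
                 2 ≤ n → n ≤ k + k
pd-lower-bound c pd (s≤s (s≤s _)) =
  let (F , (_ , proper) , 0∤1) = pd Fin.zero (Fin.suc Fin.zero) (λ ())
  in  CutBound.cut-bound c {F} proper 0∤1

module TwoLayers {n k : ℕ} .{{_ : NonZero k}} (place : Fin n → Fin k ⊎ Fin k)
                 (place-injective : Injective _≡_ _≡_ place) where

  -- Which of the two layers a position lies in; its residue is reduce.
  upper : Fin k ⊎ Fin k → Bool
  upper (inj₁ _) = false
  upper (inj₂ _) = true

  position-injective : ∀ {s t} → reduce s ≡ reduce t → upper s ≡ upper t → s ≡ t
  position-injective {inj₁ _} {inj₁ _} refl _ = refl
  position-injective {inj₂ _} {inj₂ _} refl _ = refl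
  position-injective {inj₁ _} {inj₂ _} _ ()
  position-injective {inj₂ _} {inj₁ _} _ ()

  residue : Fin n → Fin k
  residue = reduce ∘ place

  layer : Fin n → Bool
  layer = upper ∘ place

  vertex-injective : ∀ {u v} → residue u ≡ residue v → layer u ≡ layer v → u ≡ v
  vertex-injective ρ l = place-injective (position-injective ρ l)

  colouring : EdgeColoring (K n) k
  colouring = record
    { col     = λ u v → residue u ⊕ residue v
    ; col-sym = λ {u} {v} _ → ⊕-comm (residue u) (residue v)
    }

  labelling : (Fin k → Bool) → Fin n → Bool
  labelling t v = layer v xor t (residue v)

  labelling-splits-residues : ∀ t {v w} → residue v ≡ residue w →
                              labelling t v ≡ labelling t w → v ≡ w
  labelling-splits-residues t {v} {w} ρ e =
    vertex-injective ρ (xor-cancelʳ (trans e (cong ((layer w xor_) ∘ t) (sym ρ))))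

  -- Two cut edges uv, uw with equal colours have ρ v = ρ w, and v, w both
  -- carry the label opposite to u; hence v = w.
  boundary-properly-coloured : ∀ t → ProperlyColoured colouring (boundary (labelling t))
  boundary-properly-coloured t u v w (_ , gu≢gv) (_ , gu≢gw) v≢w same =
    v≢w (labelling-splits-residues t (⊕-cancelˡ (residue u) same)
          (trans (¬-not (gu≢gv ∘ sym)) (sym (¬-not (gu≢gw ∘ sym)))))

  -- Different layers: keep the layer labelling.  Same layer, hence
  -- different residues: flip the residue class of x.
  separating-labelling : ∀ {x y} → x ≢ y → Σ (Fin k → Bool) λ t → labelling t x ≢ labelling t y
  separating-labelling {x} {y} x≢y with layer x Bool.≟ layer y
  ... | no lx≢ly = (λ _ → false) , λ e → lx≢ly (xor-cancelʳ e)
  ... | yes lx≡ly = flipX , λ e → true≢false (begin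
      true                ≡⟨ dec-true (residue x ≟ residue x) refl ⟨
      flipX (residue x)   ≡⟨ xor-cancelˡ {c = layer x} (trans e (cong (_xor flipX (residue y)) (sym lx≡ly))) ⟩
      flipX (residue y)   ≡⟨ dec-false (residue y ≟ residue x) ρy≢ρx ⟩
      false               ∎)
    where
    open ≡-Reasoning
    flipX : Fin k → Bool
    flipX r = does (r ≟ residue x)

    ρy≢ρx : residue y ≢ residue x
    ρy≢ρx ρ = x≢y (vertex-injective (sym ρ) lx≡ly)

    true≢false : true ≢ false
    true≢false ()

  properDisconnected : ProperDisconnected (K n) colouring
  properDisconnected = boundaries⇒properDisconnected colouring λ x y x≢y →
    let (t , separates) = separating-labelling x≢y
    in  labelling t , boundary-properly-coloured t , separates

theorem3p5 : (n : ℕ) → 2 ≤ n → IsPD (K n) ⌈ n /2⌉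
theorem3p5 (suc zero) (s≤s ())
theorem3p5 n@(suc (suc _)) 2≤n =
  (colouring , properDisconnected) ,
  λ k c pd → ⌈n/2⌉≤k (pd-lower-bound c pd 2≤n)
  where
  placement : Σ (Fin n → Fin ⌈ n /2⌉ ⊎ Fin ⌈ n /2⌉) (Injective _≡_ _≡_)
  placement = ≤⇒⊎-injection (n≤⌈n/2⌉+⌈n/2⌉ n)
  open TwoLayers (proj₁ placement) (proj₂ placement)
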